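{- Let $k\ge1$. Extend the $(N,k)$-growth game by additionally allowing, at any time and for any $1\le i<j\le k$, the move $(a_1,\dots,a_k)\to(0,\dots,0,a_1,\dots,a_{i-1},\sum_{\ell=i}^j a_\ell,a_{j+1},\dots,a_k)$ (with $j-i$ leading zeros), in which $A_i,\dots,A_j$ are merged into a new $A_j$, the subarrays $A_1,\dots,A_{i-1}$ become $A_{j-i+1},\dots,A_{j-1}$, $A_1,\dots,A_{j-i}$ become empty, no new item is added, and the cost is $\sum_{\ell=i}^j a_\ell$. Then for every $N\ge0$ the minimum total cost of inserting $N$ items in the extended game equals $C_{N,k}$, the minimum total cost in the original $(N,k)$-growth game.
   Context: The $(N,k)$-growth game: there are $k$ subarrays $A_1,\dots,A_k$, initially empty, with $a_i$ items in $A_i$; all nonempty subarrays are full and the empty ones form a prefix. $N$ items are inserted one at a time: if some subarray is empty, the last empty subarray $A_i$ (largest $i$ with $a_i=0$) becomes a subarray containing just the new item, cost $1$; otherwise the player chooses $i\in\{1,\dots,k\}$, and $A_1,\dots,A_i$ together with the new item are merged into a new $A_i$ with $a_i\leftarrow 1+\sum_{j=1}^i a_j$, while $A_1,\dots,A_{i-1}$ become empty; cost $1+\sum_{j=1}^i a_j$. $C_{N,k}$ is the minimum total cost of inserting $N$ items. -}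

module Defs where

open import Data.Nat using (ℕ; zero; suc; _+_; _∸_; _≤_; _<_)
open import Data.List using (List; []; _∷_; _++_; length; replicate)
open import Data.Nat.ListAction using (sum)
open import Data.List.Relation.Unary.All using (All)
open import Data.Product using (_×_)
open import Relation.Binary.PropositionalEquality using (_≡_)

-- A configuration (a₁,…,a_k) is the list [a₁, …, a_k] (list position 0 = A₁).
State : Set
State = List ℕ

data InsStep (s : State) : State → ℕ → Set where
  -- some subarray is empty: the last empty one (all later ones nonempty)
  -- receives the new item, cost 1
  fill  : (pre post : State) → All (0 <_) post →
          s ≡ pre ++ 0 ∷ post →
          InsStep s (pre ++ 1 ∷ post) 1
  -- no subarray is empty: the player chooses i = length pre + 1 and
  -- A₁,…,A_i together with the new item are merged into a new A_i
  merge : (pre : State) (a : ℕ) (post : State) →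
          All (0 <_) s →
          s ≡ pre ++ a ∷ post →
          InsStep s (replicate (length pre) 0 ++ (1 + sum pre + a) ∷ post)
                    (1 + sum pre + a)

-- The additional move of the extended game (no item inserted):
-- i = length pre + 1, j = length pre + length mid, i < j (length mid ≥ 2);
-- result (0,…,0 [j-i zeros], a₁,…,a_{i-1}, Σ_{ℓ=i}^j a_ℓ, a_{j+1},…,a_k),
-- cost Σ_{ℓ=i}^j a_ℓ.
data MergeStep (s : State) : State → ℕ → Set where
  mergeRange : (pre mid post : State) → 2 ≤ length mid →
               s ≡ pre ++ mid ++ post →
               MergeStep s (replicate (length mid ∸ 1) 0 ++ pre ++ sum mid ∷ post)
                         (sum mid)

data Orig : State → ℕ → ℕ → Set where
  done : ∀ {s} → Orig s 0 0
  ins  : ∀ {s t n c d} → InsStep s t c → Orig t n d → Orig s (suc n) (c + d)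

-- Ext s n c : the same for the extended game (extra merge moves allowed at
-- any time, including before the first and after the last insertion).
data Ext : State → ℕ → ℕ → Set where
  done : ∀ {s} → Ext s 0 0
  ins  : ∀ {s t n c d} → InsStep s t c → Ext t n d → Ext s (suc n) (c + d)
  mrg  : ∀ {s t n c d} → MergeStep s t c → Ext t n d → Ext s n (c + d)

IsMin : (ℕ → Set) → ℕ → Set
IsMin P c = P c × (∀ c′ → P c′ → c ≤ c′)

initial : ℕ → State
initial k = replicate k 0

{-# OPTIONS --safe #-}
module Submission where

-- Give every item a depth: the number of moves (insertions or merges of either kind) it has
-- taken part in.  A move costs exactly the number of items it involves, so the cost of a play
-- is the total depth of the N items at its end.  Put
--   capacity i 0 = 0,  capacity i (w + 1) = 1 + capacityUpTo i w,  capacityUpTo i w = Σ_{j ≤ i} capacity j w.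
-- In every configuration of the extended game, A_i holds at most capacity i w items of depth ≤ w:
-- the subarray A_j formed by a move receives at most the new item (of depth 1) and the items of
-- A_1, …, A_j, each one level deeper, while the other subarrays only move to the right, where
-- capacities are larger.  So at most capacityUpTo k w of the N items have depth ≤ w, and every
-- play costs at least  optimalCost k N = Σ_{w < N} (N ∸ capacityUpTo k w).
-- The original game attains this bound: insert a items into A_1, …, A_k, merge them all into A_k
-- with the next item, then insert b items into A_1, …, A_{k-1}.  The cost of this recursion is
-- at most optimalCost as soon as (a, b) is comparable with every point
-- (capacityUpTo k u, capacityUpTo (k - 1) (u + 1)) of a monotone staircase, and such a split of
-- the remaining items always exists.

open import Defs
open import Data.Nat
open import Data.Nat.Properties
open import Data.Nat.Induction using (<-rec)
open import Data.Nat.Tactic.RingSolver using (solve-∀)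
open import Data.Nat.ListAction using (sum)
open import Data.Nat.ListAction.Properties using (sum-++)
open import Data.List using (List; []; _∷_; _++_; _∷ʳ_; [_]; length; replicate; map; concat; initLast; _∷ʳ′_)
open import Data.List.Properties
  using (++-assoc; length-++; length-map; length-replicate; map-++; map-∘; map-replicate; concat-++; ∷-injective)
open import Data.List.Relation.Unary.All using (All; [])
open import Data.List.Relation.Unary.All.Properties using (∷ʳ⁺)
open import Data.Product using (Σ; ∃; ∃₂; _×_; _,_)
open import Data.Sum using (_⊎_; inj₁; inj₂)
open import Data.Unit using (⊤; tt)
open import Data.Empty using (⊥-elim)
open import Function using (_∘_)
open import Relation.Nullary using (yes; no)
open import Relation.Binary.PropositionalEquality hiding ([_])

map-++⁻ : ∀ {A B : Set} (f : A → B) xs {ys zs} → map f xs ≡ ys ++ zs →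
          ∃₂ λ xs₁ xs₂ → xs ≡ xs₁ ++ xs₂ × map f xs₁ ≡ ys × map f xs₂ ≡ zs
map-++⁻ f xs       {[]}     refl = [] , xs , refl , refl , refl
map-++⁻ f []       {y ∷ ys} ()
map-++⁻ f (x ∷ xs) {y ∷ ys} eq with ∷-injective eq
... | refl , eq′ with map-++⁻ f xs {ys} eq′
... | xs₁ , xs₂ , refl , refl , refl = x ∷ xs₁ , xs₂ , refl , refl , refl

length-concat : ∀ {A : Set} (xss : List (List A)) → length (concat xss) ≡ sum (map length xss)
length-concat []         = refl
length-concat (xs ∷ xss) = trans (length-++ xs) (cong (length xs +_) (length-concat xss))

concat-empties : ∀ {A : Set} d → concat (replicate d ([] {A = A})) ≡ []
concat-empties zero    = refl
concat-empties (suc d) = concat-empties d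

sum-zeros : ∀ d → sum (replicate d 0) ≡ 0
sum-zeros zero    = refl
sum-zeros (suc d) = sum-zeros d

length-∷ʳ : ∀ (xs : List ℕ) x → length (xs ∷ʳ x) ≡ suc (length xs)
length-∷ʳ xs x = trans (length-++ xs) (+-comm (length xs) 1)

sum-∷ʳ : ∀ xs x → sum (xs ∷ʳ x) ≡ sum xs + x
sum-∷ʳ xs x = trans (sum-++ xs [ x ]) (cong (sum xs +_) (+-identityʳ x))

sum-map-suc : ∀ xs → sum (map suc xs) ≡ length xs + sum xs
sum-map-suc []       = refl
sum-map-suc (x ∷ xs) = begin
  suc x + sum (map suc xs)       ≡⟨ cong (suc x +_) (sum-map-suc xs) ⟩
  suc x + (length xs + sum xs)   ≡⟨ cong suc (+-comm-middle x (length xs) (sum xs)) ⟩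
  suc (length xs + (x + sum xs)) ∎
  where
    open ≡-Reasoning
    +-comm-middle : ∀ a b c → a + (b + c) ≡ b + (a + c)
    +-comm-middle = solve-∀

-- Capacities and the cost formula

mutual
  capacity : ℕ → ℕ → ℕ
  capacity i zero    = 0
  capacity i (suc w) = suc (capacityUpTo i w)

  capacityUpTo : ℕ → ℕ → ℕ
  capacityUpTo zero    w = 0
  capacityUpTo (suc i) w = capacityUpTo i w + capacity (suc i) w

monotone-from-suc : (f : ℕ → ℕ) → (∀ u → f u ≤ f (suc u)) → ∀ {u v} → u ≤ v → f u ≤ f v
monotone-from-suc f step u≤v = go (≤⇒≤′ u≤v)
  where
    go : ∀ {u v} → u ≤′ v → f u ≤ f v
    go ≤′-refl      = ≤-refl
    go (≤′-step p) = ≤-trans (go p) (step _)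

capacity-suc-monoˡ : ∀ i w → capacity i w ≤ capacity (suc i) w
capacity-suc-monoˡ i zero    = z≤n
capacity-suc-monoˡ i (suc w) = s≤s (m≤m+n (capacityUpTo i w) _)

capacity-monoˡ-≤ : ∀ w {i j} → i ≤ j → capacity i w ≤ capacity j w
capacity-monoˡ-≤ w = monotone-from-suc (λ i → capacity i w) (λ i → capacity-suc-monoˡ i w)

mutual
  capacity-suc-monoʳ : ∀ i w → capacity i w ≤ capacity i (suc w)
  capacity-suc-monoʳ i zero    = z≤n
  capacity-suc-monoʳ i (suc w) = s≤s (capacityUpTo-suc-monoʳ i w)

  capacityUpTo-suc-monoʳ : ∀ i w → capacityUpTo i w ≤ capacityUpTo i (suc w)
  capacityUpTo-suc-monoʳ zero    w = z≤n
  capacityUpTo-suc-monoʳ (suc i) w =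
    +-mono-≤ (capacityUpTo-suc-monoʳ i w) (capacity-suc-monoʳ (suc i) w)

capacityUpTo-zeroʳ : ∀ i → capacityUpTo i 0 ≡ 0
capacityUpTo-zeroʳ zero    = refl
capacityUpTo-zeroʳ (suc i) = trans (+-identityʳ (capacityUpTo i 0)) (capacityUpTo-zeroʳ i)

capacityUpTo-oneʳ : ∀ i → capacityUpTo i 1 ≡ i
capacityUpTo-oneʳ zero    = refl
capacityUpTo-oneʳ (suc i) = begin
  capacityUpTo i 1 + suc (capacityUpTo (suc i) 0)
    ≡⟨ cong₂ (λ x y → x + suc y) (capacityUpTo-oneʳ i) (capacityUpTo-zeroʳ (suc i)) ⟩
  i + 1
    ≡⟨ +-comm i 1 ⟩
  suc i ∎
  where open ≡-Reasoning

capacityUpTo-twoʳ : ∀ i → i + i ≤ capacityUpTo i 2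
capacityUpTo-twoʳ zero    = z≤n
capacityUpTo-twoʳ (suc i) = begin
  suc i + suc i                         ≡⟨ regroup i ⟩
  (i + i) + 2                           ≤⟨ +-mono-≤ (capacityUpTo-twoʳ i) (s≤s (s≤s z≤n)) ⟩
  capacityUpTo i 2 + suc (suc i)        ≡⟨ cong (λ c → capacityUpTo i 2 + suc c) (sym (capacityUpTo-oneʳ (suc i))) ⟩
  capacityUpTo i 2 + capacity (suc i) 2 ∎
  where
    open ≤-Reasoning
    regroup : ∀ i → suc i + suc i ≡ (i + i) + 2
    regroup = solve-∀

capacity-oneˡ : ∀ w → capacity 1 w ≡ w
capacity-oneˡ zero    = refl
capacity-oneˡ (suc w) = cong suc (capacity-oneˡ w)

capacityUpTo-inflationary : ∀ i w → w ≤ capacityUpTo (suc i) w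
capacityUpTo-inflationary i w = begin
  w                     ≡⟨ sym (capacity-oneˡ w) ⟩
  capacity 1 w          ≤⟨ capacity-monoˡ-≤ w (s≤s z≤n) ⟩
  capacity (suc i) w    ≤⟨ m≤n+m _ (capacityUpTo i w) ⟩
  capacityUpTo (suc i) w ∎
  where open ≤-Reasoning

sumBelow : ℕ → (ℕ → ℕ) → ℕ
sumBelow zero    f = 0
sumBelow (suc M) f = f 0 + sumBelow M (f ∘ suc)

sumBelow-mono-≤ : ∀ M {f g : ℕ → ℕ} → (∀ w → f w ≤ g w) → sumBelow M f ≤ sumBelow M g
sumBelow-mono-≤ zero    f≤g = z≤n
sumBelow-mono-≤ (suc M) f≤g = +-mono-≤ (f≤g 0) (sumBelow-mono-≤ M (f≤g ∘ suc))

sumBelow-cong : ∀ M {f g : ℕ → ℕ} → (∀ w → f w ≡ g w) → sumBelow M f ≡ sumBelow M g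
sumBelow-cong zero    f≗g = refl
sumBelow-cong (suc M) f≗g = cong₂ _+_ (f≗g 0) (sumBelow-cong M (f≗g ∘ suc))

sumBelow-monoˡ-≤ : ∀ (f : ℕ → ℕ) {M M′} → M ≤ M′ → sumBelow M f ≤ sumBelow M′ f
sumBelow-monoˡ-≤ f z≤n       = z≤n
sumBelow-monoˡ-≤ f (s≤s M≤M′) = +-monoʳ-≤ (f 0) (sumBelow-monoˡ-≤ (f ∘ suc) M≤M′)

sumBelow-distrib-+ : ∀ M (f g : ℕ → ℕ) → sumBelow M (λ w → f w + g w) ≡ sumBelow M f + sumBelow M g
sumBelow-distrib-+ zero    f g = refl
sumBelow-distrib-+ (suc M) f g = begin
  (f 0 + g 0) + sumBelow M (λ w → f (suc w) + g (suc w))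
    ≡⟨ cong ((f 0 + g 0) +_) (sumBelow-distrib-+ M (f ∘ suc) (g ∘ suc)) ⟩
  (f 0 + g 0) + (sumBelow M (f ∘ suc) + sumBelow M (g ∘ suc))
    ≡⟨ interchange (f 0) (g 0) _ _ ⟩
  (f 0 + sumBelow M (f ∘ suc)) + (g 0 + sumBelow M (g ∘ suc)) ∎
  where
    open ≡-Reasoning
    interchange : ∀ x y z t → (x + y) + (z + t) ≡ (x + z) + (y + t)
    interchange = solve-∀

sumBelow-zero : ∀ M → sumBelow M (λ _ → 0) ≡ 0
sumBelow-zero zero    = refl
sumBelow-zero (suc M) = sumBelow-zero M

optimalCost : ℕ → ℕ → ℕ
optimalCost k N = sumBelow N (λ w → N ∸ capacityUpTo k w)

optimalCost-suc : ∀ k′ n → optimalCost (suc k′) (suc n) ≡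
  suc n + sumBelow n (λ u → n ∸ (capacityUpTo (suc k′) u + capacityUpTo k′ (suc u)))
optimalCost-suc k′ n =
  cong₂ _+_ (cong (suc n ∸_) (capacityUpTo-zeroʳ (suc k′))) (sumBelow-cong n peel)
  where
    peel : ∀ u → suc n ∸ capacityUpTo (suc k′) (suc u)
               ≡ n ∸ (capacityUpTo (suc k′) u + capacityUpTo k′ (suc u))
    peel u = cong (suc n ∸_) (trans (+-suc (capacityUpTo k′ (suc u)) _)
                                    (cong suc (+-comm (capacityUpTo k′ (suc u)) _)))

Comparable : ℕ × ℕ → ℕ × ℕ → Set
Comparable (a , b) (x , y) = (a ≤ x × b ≤ y) ⊎ (x ≤ a × y ≤ b)

-- The upper bound: a recursive strategy

∸-+-comparable : ∀ {a b x y} → Comparable (a , b) (x , y) → (a ∸ x) + (b ∸ y) ≤ (a + b) ∸ (x + y)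
∸-+-comparable (inj₁ (a≤x , b≤y)) rewrite m≤n⇒m∸n≡0 a≤x | m≤n⇒m∸n≡0 b≤y = z≤n
∸-+-comparable {a} {b} {x} {y} (inj₂ (x≤a , y≤b)) = ≤-reflexive (begin
  (a ∸ x) + (b ∸ y)   ≡⟨ sym (+-∸-assoc (a ∸ x) y≤b) ⟩
  ((a ∸ x) + b) ∸ y   ≡⟨ cong (_∸ y) (+-comm (a ∸ x) b) ⟩
  (b + (a ∸ x)) ∸ y   ≡⟨ cong (_∸ y) (sym (+-∸-assoc b x≤a)) ⟩
  ((b + a) ∸ x) ∸ y   ≡⟨ ∸-+-assoc (b + a) x y ⟩
  (b + a) ∸ (x + y)   ≡⟨ cong (_∸ (x + y)) (+-comm b a) ⟩
  (a + b) ∸ (x + y)   ∎)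
  where open ≡-Reasoning

comparable-between : (X Y : ℕ → ℕ) → (∀ u → X u ≤ X (suc u)) → (∀ u → Y u ≤ Y (suc u)) →
  ∀ {p a b} → X p ≤ a → a ≤ X (suc p) → Y p ≤ b → b ≤ Y (suc p) →
  ∀ u → Comparable (a , b) (X u , Y u)
comparable-between X Y X↑ Y↑ {p} Xp≤a a≤Xp′ Yp≤b b≤Yp′ u with u ≤? p
... | yes u≤p = inj₂ (≤-trans (monotone-from-suc X X↑ u≤p) Xp≤a ,
                      ≤-trans (monotone-from-suc Y Y↑ u≤p) Yp≤b)
... | no  u≰p = inj₁ (≤-trans a≤Xp′ (monotone-from-suc X X↑ (≰⇒> u≰p)) ,
                      ≤-trans b≤Yp′ (monotone-from-suc Y Y↑ (≰⇒> u≰p)))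

optimalCost-merge-≤ : ∀ k′ a b →
  (∀ u → Comparable (a , b) (capacityUpTo (suc k′) u , capacityUpTo k′ (suc u))) →
  suc a + (optimalCost (suc k′) a + optimalCost k′ b) ≤ optimalCost (suc k′) (suc (a + b))
optimalCost-merge-≤ k′ a b comparable = begin
  suc a + (optimalCost (suc k′) a + optimalCost k′ b)
    ≤⟨ +-monoʳ-≤ (suc a) (+-mono-≤ (sumBelow-monoˡ-≤ fa (m≤m+n a b)) right-bound) ⟩
  suc a + (sumBelow n fa + (b + sumBelow n fb))
    ≡⟨ rearrange a b (sumBelow n fa) (sumBelow n fb) ⟩
  suc n + (sumBelow n fa + sumBelow n fb)
    ≡⟨ cong (suc n +_) (sym (sumBelow-distrib-+ n fa fb)) ⟩
  suc n + sumBelow n (λ u → fa u + fb u)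
    ≤⟨ +-monoʳ-≤ (suc n) (sumBelow-mono-≤ n (∸-+-comparable ∘ comparable)) ⟩
  suc n + sumBelow n (λ u → n ∸ (capacityUpTo (suc k′) u + capacityUpTo k′ (suc u)))
    ≡⟨ sym (optimalCost-suc k′ n) ⟩
  optimalCost (suc k′) (suc n) ∎
  where
    open ≤-Reasoning
    n = a + b
    fa fb : ℕ → ℕ
    fa u = a ∸ capacityUpTo (suc k′) u
    fb u = b ∸ capacityUpTo k′ (suc u)
    right-bound : optimalCost k′ b ≤ b + sumBelow n fb
    right-bound = subst (λ c → optimalCost k′ b ≤ c + sumBelow n fb)
                        (cong (b ∸_) (capacityUpTo-zeroʳ k′))
                        (sumBelow-monoˡ-≤ (λ w → b ∸ capacityUpTo k′ w) (m≤n⇒m≤1+n (m≤n+m b a)))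
    rearrange : ∀ a b x y → suc a + (x + (b + y)) ≡ suc (a + b) + (x + y)
    rearrange = solve-∀

crossing-point : (g : ℕ → ℕ) {n M : ℕ} → g 0 < n → n ≤ g M → ∃ λ p → g p < n × n ≤ g (suc p)
crossing-point g {M = zero}  g0<n n≤g0 = ⊥-elim (<-irrefl refl (<-≤-trans g0<n n≤g0))
crossing-point g {n} {suc M} g0<n n≤gM′ with n ≤? g M
... | yes n≤gM = crossing-point g g0<n n≤gM
... | no  n≰gM = M , ≰⇒> n≰gM , n≤gM′

-- A choice of a = left and b = right in the recursive strategy for n + 1 items.
record Split (k′ n : ℕ) : Set where
  field
    left right     : ℕ
    left+right≡n   : left + right ≡ n
    left-0-or-full : left ≡ 0 ⊎ suc k′ ≤ left
    right-full     : k′ ≤ n → k′ ≤ right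
    right-0        : k′ ≡ 0 → right ≡ 0
    comparable     : ∀ u → Comparable (left , right)
                                      (capacityUpTo (suc k′) u , capacityUpTo k′ (suc u))

module _ (k′ : ℕ) where
  private
    X Y : ℕ → ℕ
    X = capacityUpTo (suc k′)
    Y u = capacityUpTo k′ (suc u)

    X↑ : ∀ u → X u ≤ X (suc u)
    X↑ = capacityUpTo-suc-monoʳ (suc k′)

    Y↑ : ∀ u → Y u ≤ Y (suc u)
    Y↑ u = capacityUpTo-suc-monoʳ k′ (suc u)

    Y-zero : Y 0 ≡ k′
    Y-zero = capacityUpTo-oneʳ k′

    X-one : X 1 ≡ suc k′
    X-one = capacityUpTo-oneʳ (suc k′)

  split-small : ∀ n → n ≤ Y 1 → Split k′ n
  split-small n n≤Y1 = record
    { left = 0 ; right = n ; left+right≡n = refl ; left-0-or-full = inj₁ refl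
    ; right-full = λ k′≤n → k′≤n
    ; right-0 = λ { refl → n≤0⇒n≡0 n≤Y1 }
    ; comparable = comparable }
    where
      comparable : ∀ u → Comparable (0 , n) (X u , Y u)
      comparable u with k′ ≤? n
      ... | yes k′≤n = comparable-between X Y X↑ Y↑ {p = 0}
                         (≤-reflexive (capacityUpTo-zeroʳ (suc k′))) z≤n
                         (≤-trans (≤-reflexive Y-zero) k′≤n) n≤Y1 u
      ... | no  k′≰n = inj₁ (z≤n , ≤-trans (<⇒≤ (≰⇒> k′≰n))
                                     (≤-trans (≤-reflexive (sym Y-zero))
                                              (monotone-from-suc Y Y↑ z≤n)))

  split-large : ∀ n p → Y 1 < n → X p + Y p < n → n ≤ X (suc p) + Y (suc p) → Split k′ n
  split-large n p Y1<n gp<n n≤gp′ = record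
    { left = a ; right = n ∸ a ; left+right≡n = m+[n∸m]≡n a≤n
    ; left-0-or-full = inj₂ k≤a
    ; right-full = λ _ → ≤-trans (≤-reflexive (sym Y-zero)) (≤-trans (monotone-from-suc Y Y↑ z≤n) Yp≤b)
    ; right-0 = λ { refl → n≤0⇒n≡0 b≤Yp′ }
    ; comparable = comparable-between X Y X↑ Y↑ Xp≤a a≤Xp′ Yp≤b b≤Yp′ }
    where
      -- the least a ≥ X p, k with n ∸ a ≤ Y (p + 1); it is then also ≤ X (p + 1) and ≤ n ∸ Y p.
      a : ℕ
      a = (X p ⊔ suc k′) ⊔ (n ∸ Y (suc p))

      Xp≤a : X p ≤ a
      Xp≤a = ≤-trans (m≤m⊔n (X p) (suc k′)) (m≤m⊔n _ _)

      k≤a : suc k′ ≤ a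
      k≤a = ≤-trans (m≤n⊔m (X p) (suc k′)) (m≤m⊔n _ _)

      n∸Yp′≤a : n ∸ Y (suc p) ≤ a
      n∸Yp′≤a = m≤n⊔m (X p ⊔ suc k′) (n ∸ Y (suc p))

      k≤X : ∀ {u} → 1 ≤ u → suc k′ ≤ X u
      k≤X 1≤u = ≤-trans (≤-reflexive (sym X-one)) (monotone-from-suc X X↑ 1≤u)

      k+Y≤n : ∀ q → X q + Y q < n → suc k′ + Y q ≤ n
      k+Y≤n zero    _     = subst (λ y → suc k′ + y ≤ n) (sym Y-zero)
                                  (≤-<-trans (capacityUpTo-twoʳ k′) Y1<n)
      k+Y≤n (suc q) gq<n = ≤-trans (+-monoˡ-≤ (Y (suc q)) (k≤X (s≤s z≤n))) (<⇒≤ gq<n)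

      a≤n∸Yp : a ≤ n ∸ Y p
      a≤n∸Yp = ⊔-lub (⊔-lub (m+n≤o⇒m≤o∸n (X p) (<⇒≤ gp<n)) (m+n≤o⇒m≤o∸n (suc k′) (k+Y≤n p gp<n)))
                     (∸-monoʳ-≤ n (Y↑ p))

      a+Yp≤n : a + Y p ≤ n
      a+Yp≤n = m≤o∸n⇒m+n≤o a (m+n≤o⇒n≤o (X p) (<⇒≤ gp<n)) a≤n∸Yp

      a≤n : a ≤ n
      a≤n = m+n≤o⇒m≤o a a+Yp≤n

      a≤Xp′ : a ≤ X (suc p)
      a≤Xp′ = ⊔-lub (⊔-lub (X↑ p) (k≤X (s≤s z≤n)))
                    (m≤n+o⇒m∸n≤o n (Y (suc p)) (≤-trans n≤gp′ (≤-reflexive (+-comm (X (suc p)) _))))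

      Yp≤b : Y p ≤ n ∸ a
      Yp≤b = m+n≤o⇒m≤o∸n (Y p) (≤-trans (≤-reflexive (+-comm (Y p) a)) a+Yp≤n)

      b≤Yp′ : n ∸ a ≤ Y (suc p)
      b≤Yp′ = m≤n+o⇒m∸n≤o n a (begin
        n                          ≤⟨ m≤n+m∸n n (Y (suc p)) ⟩
        Y (suc p) + (n ∸ Y (suc p)) ≤⟨ +-monoʳ-≤ (Y (suc p)) n∸Yp′≤a ⟩
        Y (suc p) + a              ≡⟨ +-comm (Y (suc p)) a ⟩
        a + Y (suc p)              ∎)
        where open ≤-Reasoning

  split : ∀ n → Split k′ n
  split n with n ≤? Y 1
  ... | yes small = split-small n small
  ... | no  large with crossing-point (λ u → X u + Y u) g0<n n≤gn
    where
      g0<n : X 0 + Y 0 < n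
      g0<n = subst (_< n) (sym (cong₂ _+_ (capacityUpTo-zeroʳ (suc k′)) Y-zero))
                   (≤-<-trans (m≤m+n k′ k′) (≤-<-trans (capacityUpTo-twoʳ k′) (≰⇒> large)))
      n≤gn : n ≤ X n + Y n
      n≤gn = ≤-trans (capacityUpTo-inflationary k′ n) (m≤m+n (X n) (Y n))
  ... | p , gp<n , n≤gp′ = split-large n p (≰⇒> large) gp<n n≤gp′

data Run : State → ℕ → ℕ → State → Set where
  stop : ∀ {s} → Run s 0 0 s
  step : ∀ {s t u n c d} → InsStep s t c → Run t n d u → Run s (suc n) (c + d) u

Run⇒Orig : ∀ {s n c t} → Run s n c t → Orig s n c
Run⇒Orig stop         = done
Run⇒Orig (step i run) = ins i (Run⇒Orig run)

Orig⇒Ext : ∀ {s n c} → Orig s n c → Ext s n c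
Orig⇒Ext done       = done
Orig⇒Ext (ins i o) = ins i (Orig⇒Ext o)

Run-++ : ∀ {s t u n m c d} → Run s n c t → Run t m d u → Run s (n + m) (c + d) u
Run-++ stop run′ = run′
Run-++ {d = d′} (step {c = c} {d = d} i run) run′ rewrite +-assoc c d d′ = step i (Run-++ run run′)

InsStep-∷ʳ : ∀ {s t c x} → 0 < x → InsStep s t c → InsStep (s ∷ʳ x) (t ∷ʳ x) c
InsStep-∷ʳ {x = x} 0<x (fill pre post full refl) rewrite ++-assoc pre (1 ∷ post) [ x ] =
  fill pre (post ∷ʳ x) (∷ʳ⁺ full 0<x) (++-assoc pre (0 ∷ post) [ x ])
InsStep-∷ʳ {x = x} 0<x (merge pre a post full refl)
  rewrite ++-assoc (replicate (length pre) 0) (1 + sum pre + a ∷ post) [ x ] =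
  merge pre a (post ∷ʳ x) (∷ʳ⁺ full 0<x) (++-assoc pre (a ∷ post) [ x ])

Run-∷ʳ : ∀ {s n c t x} → 0 < x → Run s n c t → Run (s ∷ʳ x) n c (t ∷ʳ x)
Run-∷ʳ 0<x stop         = stop
Run-∷ʳ 0<x (step i run) = step (InsStep-∷ʳ 0<x i) (Run-∷ʳ 0<x run)

initial-∷ʳ : ∀ k → initial (suc k) ≡ initial k ∷ʳ 0
initial-∷ʳ zero    = refl
initial-∷ʳ (suc k) = cong (0 ∷_) (initial-∷ʳ k)

mergeAll : ∀ {k′} s → All (0 <_) s → length s ≡ suc k′ →
           InsStep s (initial k′ ∷ʳ suc (sum s)) (suc (sum s))
mergeAll s full len with initLast s
... | pre ∷ʳ′ x rewrite sum-∷ʳ pre x =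
  subst (λ l → InsStep (pre ∷ʳ x) (replicate l 0 ∷ʳ suc (sum pre + x)) (suc (sum pre + x)))
        (suc-injective (trans (sym (length-∷ʳ pre x)) len))
        (merge pre x [] full refl)

record CheapRun (k N : ℕ) : Set where
  field
    final   : State
    cost    : ℕ
    run     : Run (initial k) N cost final
    cost≤   : cost ≤ optimalCost k N
    length≡ : length final ≡ k
    sum≡    : sum final ≡ N
    full    : k ≤ N → All (0 <_) final

cheapRun-zero : ∀ k → CheapRun k 0
cheapRun-zero k = record
  { final = initial k ; cost = 0 ; run = stop ; cost≤ = z≤n
  ; length≡ = length-replicate k ; sum≡ = sum-zeros k ; full = λ { z≤n → [] } }

cheapRun-fillLast : ∀ {k′ a b} → a ≡ 0 → CheapRun k′ b →
  (∀ u → Comparable (a , b) (capacityUpTo (suc k′) u , capacityUpTo k′ (suc u))) →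
  CheapRun (suc k′) (suc (a + b))
cheapRun-fillLast {k′} {b = b} refl R comparable = record
  { final   = final ∷ʳ 1
  ; cost    = 1 + cost
  ; run     = step (fill (initial k′) [] [] (initial-∷ʳ k′)) (Run-∷ʳ (s≤s z≤n) run)
  ; cost≤   = ≤-trans (s≤s cost≤) (optimalCost-merge-≤ k′ 0 b comparable)
  ; length≡ = trans (length-∷ʳ final 1) (cong suc length≡)
  ; sum≡    = trans (sum-∷ʳ final 1) (trans (+-comm _ 1) (cong suc sum≡))
  ; full    = λ k≤N → ∷ʳ⁺ (full (≤-pred k≤N)) (s≤s z≤n) }
  where open CheapRun R

cheapRun-mergeAll : ∀ {k′ a b} → CheapRun (suc k′) a → suc k′ ≤ a → CheapRun k′ b →
  (k′ ≤ a + b → k′ ≤ b) →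
  (∀ u → Comparable (a , b) (capacityUpTo (suc k′) u , capacityUpTo k′ (suc u))) →
  CheapRun (suc k′) (suc (a + b))
cheapRun-mergeAll {k′} {a} {b} A k≤a B right-full comparable = record
  { final   = B.final ∷ʳ suc a
  ; cost    = A.cost + (suc a + B.cost)
  ; run     = subst (λ N → Run (initial (suc k′)) N (A.cost + (suc a + B.cost)) (B.final ∷ʳ suc a))
                    (+-suc a b) (Run-++ A.run (step mergeStep (Run-∷ʳ (s≤s z≤n) B.run)))
  ; cost≤   = cost≤
  ; length≡ = trans (length-∷ʳ B.final (suc a)) (cong suc B.length≡)
  ; sum≡    = trans (sum-∷ʳ B.final (suc a))
                    (trans (+-suc (sum B.final) a) (cong suc (trans (cong (_+ a) B.sum≡) (+-comm b a))))
  ; full    = λ k≤N → ∷ʳ⁺ (B.full (right-full (≤-pred k≤N))) (s≤s z≤n) }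
  where
    module A = CheapRun A
    module B = CheapRun B
    mergeStep : InsStep A.final (initial k′ ∷ʳ suc a) (suc a)
    mergeStep = subst (λ c → InsStep A.final (initial k′ ∷ʳ suc c) (suc c)) A.sum≡
                      (mergeAll A.final (A.full k≤a) A.length≡)
    cost≤ : A.cost + (suc a + B.cost) ≤ optimalCost (suc k′) (suc (a + b))
    cost≤ = begin
      A.cost + (suc a + B.cost)
        ≤⟨ +-mono-≤ A.cost≤ (+-monoʳ-≤ (suc a) B.cost≤) ⟩
      optimalCost (suc k′) a + (suc a + optimalCost k′ b)
        ≡⟨ rearrange (optimalCost (suc k′) a) (suc a) (optimalCost k′ b) ⟩
      suc a + (optimalCost (suc k′) a + optimalCost k′ b)
        ≤⟨ optimalCost-merge-≤ k′ a b comparable ⟩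
      optimalCost (suc k′) (suc (a + b)) ∎
      where
        open ≤-Reasoning
        rearrange : ∀ x y z → x + (y + z) ≡ y + (x + z)
        rearrange = solve-∀

cheapRun-fewer : ∀ k′ {b} → (k′ ≡ 0 → b ≡ 0) → (∀ k″ → CheapRun (suc k″) b) → CheapRun k′ b
cheapRun-fewer zero     b≡0 _   rewrite b≡0 refl = cheapRun-zero 0
cheapRun-fewer (suc k″) _   run = run k″

cheapRun : ∀ k′ N → CheapRun (suc k′) N
cheapRun k′ N = <-rec (λ N → ∀ k′ → CheapRun (suc k′) N) build N k′
  where
    build : ∀ N → (∀ {M} → M < N → ∀ k′ → CheapRun (suc k′) M) → ∀ k′ → CheapRun (suc k′) N
    build zero    _     k′ = cheapRun-zero (suc k′)
    build (suc n) recur k′ = subst (CheapRun (suc k′) ∘ suc) left+right≡n (combine left-0-or-full)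
      where
        open Split (split k′ n)
        right-run : CheapRun k′ right
        right-run = cheapRun-fewer k′ right-0 (recur (s≤s (m+n≤o⇒n≤o left (≤-reflexive left+right≡n))))
        combine : left ≡ 0 ⊎ suc k′ ≤ left → CheapRun (suc k′) (suc (left + right))
        combine (inj₁ left≡0) = cheapRun-fillLast left≡0 right-run comparable
        combine (inj₂ k≤left) =
          cheapRun-mergeAll (recur (s≤s (m+n≤o⇒m≤o left (≤-reflexive left+right≡n))) k′) k≤left
                            right-run (right-full ∘ subst (k′ ≤_) left+right≡n) comparable

-- The lower bound: depths of items

indicator≤ : ℕ → ℕ → ℕ
indicator≤ zero    w       = 1
indicator≤ (suc x) zero    = 0
indicator≤ (suc x) (suc w) = indicator≤ x w

count≤ : ℕ → List ℕ → ℕ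
count≤ w xs = sum (map (λ x → indicator≤ x w) xs)

count≤-++ : ∀ w xs ys → count≤ w (xs ++ ys) ≡ count≤ w xs + count≤ w ys
count≤-++ w xs ys = trans (cong sum (map-++ _ xs ys)) (sum-++ (map _ xs) _)

count≤-zero-map-suc : ∀ xs → count≤ 0 (map suc xs) ≡ 0
count≤-zero-map-suc []       = refl
count≤-zero-map-suc (x ∷ xs) = count≤-zero-map-suc xs

count≤-suc-map-suc : ∀ w xs → count≤ (suc w) (map suc xs) ≡ count≤ w xs
count≤-suc-map-suc w xs = cong sum (sym (map-∘ xs))

[m+n]∸[o+p]≤[m∸o]+[n∸p] : ∀ m n o p → (m + n) ∸ (o + p) ≤ (m ∸ o) + (n ∸ p)
[m+n]∸[o+p]≤[m∸o]+[n∸p] m n o p = m≤n+o⇒m∸n≤o (m + n) (o + p) (begin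
  m + n                             ≤⟨ +-mono-≤ (m≤n+m∸n m o) (m≤n+m∸n n p) ⟩
  (o + (m ∸ o)) + (p + (n ∸ p))     ≡⟨ interchange o (m ∸ o) p (n ∸ p) ⟩
  (o + p) + ((m ∸ o) + (n ∸ p))     ∎)
  where
    open ≤-Reasoning
    interchange : ∀ a b c d → (a + b) + (c + d) ≡ (a + c) + (b + d)
    interchange = solve-∀

sumBelow-indicator> : ∀ M x → sumBelow M (λ w → 1 ∸ indicator≤ x w) ≤ x
sumBelow-indicator> M       zero    = ≤-reflexive (sumBelow-zero M)
sumBelow-indicator> zero    (suc x) = z≤n
sumBelow-indicator> (suc M) (suc x) = s≤s (sumBelow-indicator> M x)

sumBelow-count>-≤-sum : ∀ M xs → sumBelow M (λ w → length xs ∸ count≤ w xs) ≤ sum xs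
sumBelow-count>-≤-sum M []       = ≤-reflexive (sumBelow-zero M)
sumBelow-count>-≤-sum M (x ∷ xs) = begin
  sumBelow M (λ w → (1 + length xs) ∸ (indicator≤ x w + count≤ w xs))
    ≤⟨ sumBelow-mono-≤ M (λ w → [m+n]∸[o+p]≤[m∸o]+[n∸p] 1 (length xs) (indicator≤ x w) _) ⟩
  sumBelow M (λ w → (1 ∸ indicator≤ x w) + (length xs ∸ count≤ w xs))
    ≡⟨ sumBelow-distrib-+ M _ _ ⟩
  sumBelow M (λ w → 1 ∸ indicator≤ x w) + sumBelow M (λ w → length xs ∸ count≤ w xs)
    ≤⟨ +-mono-≤ (sumBelow-indicator> M x) (sumBelow-count>-≤-sum M xs) ⟩
  x + sum xs ∎
  where open ≤-Reasoning

-- A configuration whose subarrays list the depths of their items.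
Depths : Set
Depths = List (List ℕ)

-- The lists of Ds sit at positions p + 1, p + 2, … .
WithinCapacity : ℕ → Depths → Set
WithinCapacity p []        = ⊤
WithinCapacity p (ds ∷ Ds) = (∀ w → count≤ w ds ≤ capacity (suc p) w) × WithinCapacity (suc p) Ds

within-monoˡ : ∀ {p q} As → p ≤ q → WithinCapacity p As → WithinCapacity q As
within-monoˡ []        p≤q _               = tt
within-monoˡ (ds ∷ As) p≤q (ds-ok , As-ok) =
  (λ w → ≤-trans (ds-ok w) (capacity-monoˡ-≤ w (s≤s p≤q))) , within-monoˡ As (s≤s p≤q) As-ok

within-++⁻ : ∀ p As {Bs} → WithinCapacity p (As ++ Bs) →
             WithinCapacity p As × WithinCapacity (p + length As) Bs
within-++⁻ p [] {Bs}        ok = tt , within-monoˡ Bs (≤-reflexive (sym (+-identityʳ p))) ok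
within-++⁻ p (ds ∷ As) {Bs} (ds-ok , ok) with within-++⁻ (suc p) As ok
... | As-ok , Bs-ok = (ds-ok , As-ok) , within-monoˡ Bs (≤-reflexive (sym (+-suc p (length As)))) Bs-ok

within-++⁺ : ∀ p As {Bs} → WithinCapacity p As → WithinCapacity (p + length As) Bs →
             WithinCapacity p (As ++ Bs)
within-++⁺ p []        {Bs} _               Bs-ok = within-monoˡ Bs (≤-reflexive (+-identityʳ p)) Bs-ok
within-++⁺ p (ds ∷ As) {Bs} (ds-ok , As-ok) Bs-ok =
  ds-ok , within-++⁺ (suc p) As As-ok (within-monoˡ Bs (≤-reflexive (+-suc p (length As))) Bs-ok)

within-empties : ∀ p d → WithinCapacity p (replicate d [])
within-empties p zero    = tt
within-empties p (suc d) = (λ w → z≤n) , within-empties (suc p) d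

count≤-concat : ∀ p As → WithinCapacity p As → ∀ w →
  count≤ w (concat As) + capacityUpTo p w ≤ capacityUpTo (p + length As) w
count≤-concat p []        _               w = ≤-reflexive (cong (λ q → capacityUpTo q w) (sym (+-identityʳ p)))
count≤-concat p (ds ∷ As) (ds-ok , As-ok) w = begin
  count≤ w (ds ++ concat As) + capacityUpTo p w
    ≡⟨ cong (_+ capacityUpTo p w) (count≤-++ w ds (concat As)) ⟩
  (count≤ w ds + count≤ w (concat As)) + capacityUpTo p w
    ≡⟨ rotate (count≤ w ds) (count≤ w (concat As)) (capacityUpTo p w) ⟩
  count≤ w (concat As) + (capacityUpTo p w + count≤ w ds)
    ≤⟨ +-monoʳ-≤ (count≤ w (concat As)) (+-monoʳ-≤ (capacityUpTo p w) (ds-ok w)) ⟩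
  count≤ w (concat As) + capacityUpTo (suc p) w
    ≤⟨ count≤-concat (suc p) As As-ok w ⟩
  capacityUpTo (suc p + length As) w
    ≡⟨ cong (λ q → capacityUpTo q w) (sym (+-suc p (length As))) ⟩
  capacityUpTo (p + suc (length As)) w ∎
  where
    open ≤-Reasoning
    rotate : ∀ a b c → (a + b) + c ≡ b + (c + a)
    rotate = solve-∀

InsStep-sum : ∀ {s t c} → InsStep s t c → sum t ≡ suc (sum s)
InsStep-sum (fill pre post _ refl) = begin
  sum (pre ++ 1 ∷ post)           ≡⟨ sum-++ pre (1 ∷ post) ⟩
  sum pre + suc (sum post)        ≡⟨ +-suc (sum pre) (sum post) ⟩
  suc (sum pre + sum post)        ≡⟨ cong suc (sym (sum-++ pre (0 ∷ post))) ⟩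
  suc (sum (pre ++ 0 ∷ post))     ∎
  where open ≡-Reasoning
InsStep-sum (merge pre a post _ refl) = begin
  sum (replicate (length pre) 0 ++ (1 + sum pre + a) ∷ post)
    ≡⟨ sum-++ (replicate (length pre) 0) _ ⟩
  sum (replicate (length pre) 0) + ((1 + sum pre + a) + sum post)
    ≡⟨ cong (_+ ((1 + sum pre + a) + sum post)) (sum-zeros (length pre)) ⟩
  suc (sum pre + a + sum post)
    ≡⟨ cong suc (+-assoc (sum pre) a (sum post)) ⟩
  suc (sum pre + (a + sum post))
    ≡⟨ cong suc (sym (sum-++ pre (a ∷ post))) ⟩
  suc (sum (pre ++ a ∷ post)) ∎
  where open ≡-Reasoning

InsStep-length : ∀ {s t c} → InsStep s t c → length t ≡ length s
InsStep-length (fill pre post _ refl)    = trans (length-++ pre) (sym (length-++ pre))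
InsStep-length (merge pre a post _ refl) =
  trans (length-++ (replicate (length pre) 0))
        (trans (cong (_+ _) (length-replicate (length pre))) (sym (length-++ pre)))

MergeStep-sum : ∀ {s t c} → MergeStep s t c → sum t ≡ sum s
MergeStep-sum (mergeRange pre mid post _ refl) = begin
  sum (replicate (length mid ∸ 1) 0 ++ pre ++ sum mid ∷ post)
    ≡⟨ sum-++ (replicate (length mid ∸ 1) 0) _ ⟩
  sum (replicate (length mid ∸ 1) 0) + sum (pre ++ sum mid ∷ post)
    ≡⟨ cong (_+ sum (pre ++ sum mid ∷ post)) (sum-zeros (length mid ∸ 1)) ⟩
  sum (pre ++ sum mid ∷ post)
    ≡⟨ sum-++ pre (sum mid ∷ post) ⟩
  sum pre + (sum mid + sum post)
    ≡⟨ cong (sum pre +_) (sym (sum-++ mid post)) ⟩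
  sum pre + sum (mid ++ post)
    ≡⟨ sym (sum-++ pre (mid ++ post)) ⟩
  sum (pre ++ mid ++ post) ∎
  where open ≡-Reasoning

MergeStep-length : ∀ {s t c} → MergeStep s t c → length t ≡ length s
MergeStep-length (mergeRange pre mid post 2≤mid refl) with length mid in mid-length
... | suc m = begin
  length (replicate m 0 ++ pre ++ sum mid ∷ post)
    ≡⟨ length-++ (replicate m 0) ⟩
  length (replicate m 0) + length (pre ++ sum mid ∷ post)
    ≡⟨ cong₂ _+_ (length-replicate m) (length-++ pre) ⟩
  m + (length pre + suc (length post))
    ≡⟨ rearrange m (length pre) (length post) ⟩
  length pre + (suc m + length post)
    ≡⟨ cong (length pre +_) (cong (_+ length post) (sym mid-length)) ⟩
  length pre + (length mid + length post)
    ≡⟨ cong (length pre +_) (sym (length-++ mid)) ⟩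
  length pre + length (mid ++ post)
    ≡⟨ sym (length-++ pre) ⟩
  length (pre ++ mid ++ post) ∎
  where
    open ≡-Reasoning
    rearrange : ∀ m p q → m + (p + suc q) ≡ p + (suc m + q)
    rearrange = solve-∀

totalDepth : Depths → ℕ
totalDepth Ds = sum (concat Ds)

totalDepth-++ : ∀ Ds Es → totalDepth (Ds ++ Es) ≡ totalDepth Ds + totalDepth Es
totalDepth-++ Ds Es = trans (cong sum (sym (concat-++ Ds Es))) (sum-++ (concat Ds) (concat Es))

totalDepth-empties : ∀ d Ds → totalDepth (replicate d [] ++ Ds) ≡ totalDepth Ds
totalDepth-empties d Ds = trans (totalDepth-++ (replicate d []) Ds)
                                (cong (λ xs → sum xs + totalDepth Ds) (concat-empties d))

deepen : Depths → List ℕ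
deepen Ds = map suc (concat Ds)

length-deepen : ∀ Ds → length (deepen Ds) ≡ sum (map length Ds)
length-deepen Ds = trans (length-map suc (concat Ds)) (length-concat Ds)

sum-deepen : ∀ Ds → sum (deepen Ds) ≡ sum (map length Ds) + totalDepth Ds
sum-deepen Ds = trans (sum-map-suc (concat Ds)) (cong (_+ totalDepth Ds) (length-concat Ds))

deepen-within : ∀ p Ds → WithinCapacity p Ds →
                ∀ w → count≤ w (1 ∷ deepen Ds) ≤ capacity (p + length Ds) w
deepen-within p Ds within zero    = ≤-reflexive (count≤-zero-map-suc (concat Ds))
deepen-within p Ds within (suc w) = s≤s (begin
  count≤ (suc w) (deepen Ds)               ≡⟨ count≤-suc-map-suc w (concat Ds) ⟩
  count≤ w (concat Ds)                     ≤⟨ m≤m+n _ (capacityUpTo p w) ⟩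
  count≤ w (concat Ds) + capacityUpTo p w ≤⟨ count≤-concat p Ds within w ⟩
  capacityUpTo (p + length Ds) w           ∎)
  where open ≤-Reasoning

-- Every move replaces a block Blk of consecutive subarrays by one subarray ys holding their items
-- one level deeper, plus possibly the new item (filling an empty A_i is the block [ [] ]); the
-- subarrays Ds before the block move right past d = length Blk ∸ 1 new empty ones.
mergeBlock-within : ∀ Ds Blk Es d {ys} → suc d ≡ length Blk →
  (∀ w → count≤ w ys ≤ count≤ w (1 ∷ deepen Blk)) →
  WithinCapacity 0 (Ds ++ Blk ++ Es) → WithinCapacity 0 (replicate d [] ++ Ds ++ ys ∷ Es)
mergeBlock-within Ds Blk Es d {ys} d<|Blk| ys≤ within
  with within-++⁻ 0 Ds within
... | Ds-ok , rest with within-++⁻ (length Ds) Blk rest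
... | Blk-ok , Es-ok =
  within-++⁺ 0 (replicate d []) (within-empties 0 d)
    (within-monoˡ (Ds ++ ys ∷ Es) (≤-reflexive (sym (length-replicate d)))
      (within-++⁺ d Ds (within-monoˡ Ds z≤n Ds-ok)
        ((λ w → ≤-trans (ys≤ w) (subst (λ i → count≤ w (1 ∷ deepen Blk) ≤ capacity i w) position
                                       (deepen-within (length Ds) Blk Blk-ok w)))
        , within-monoˡ Es (≤-reflexive position) Es-ok)))
  where
    position : length Ds + length Blk ≡ suc (d + length Ds)
    position = trans (+-comm (length Ds) _) (cong (_+ length Ds) (sym d<|Blk|))

totalDepth-mergeBlock : ∀ d Ds Blk Es {ys c} → sum ys ≡ c + totalDepth Blk →
  totalDepth (replicate d [] ++ Ds ++ ys ∷ Es) ≡ totalDepth (Ds ++ Blk ++ Es) + c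
totalDepth-mergeBlock d Ds Blk Es {ys} {c} sum-ys = begin
  totalDepth (replicate d [] ++ Ds ++ ys ∷ Es)
    ≡⟨ totalDepth-empties d (Ds ++ ys ∷ Es) ⟩
  totalDepth (Ds ++ ys ∷ Es)
    ≡⟨ totalDepth-++ Ds (ys ∷ Es) ⟩
  totalDepth Ds + sum (ys ++ concat Es)
    ≡⟨ cong (totalDepth Ds +_) (trans (sum-++ ys (concat Es)) (cong (_+ totalDepth Es) sum-ys)) ⟩
  totalDepth Ds + ((c + totalDepth Blk) + totalDepth Es)
    ≡⟨ move-c (totalDepth Ds) c (totalDepth Blk) (totalDepth Es) ⟩
  (totalDepth Ds + (totalDepth Blk + totalDepth Es)) + c
    ≡⟨ cong (λ x → (totalDepth Ds + x) + c) (sym (totalDepth-++ Blk Es)) ⟩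
  (totalDepth Ds + totalDepth (Blk ++ Es)) + c
    ≡⟨ cong (_+ c) (sym (totalDepth-++ Ds (Blk ++ Es))) ⟩
  totalDepth (Ds ++ Blk ++ Es) + c ∎
  where
    open ≡-Reasoning
    move-c : ∀ a c b e → a + ((c + b) + e) ≡ (a + (b + e)) + c
    move-c = solve-∀

shape-mergeBlock : ∀ d (Ds : Depths) ys Es →
  map length (replicate d [] ++ Ds ++ ys ∷ Es) ≡ replicate d 0 ++ map length Ds ++ length ys ∷ map length Es
shape-mergeBlock d Ds ys Es =
  trans (map-++ length (replicate d []) (Ds ++ ys ∷ Es))
        (cong₂ _++_ (map-replicate length d []) (map-++ length Ds (ys ∷ Es)))

record Deepening (Ds : Depths) (t : State) (c : ℕ) : Set where
  field
    depths : Depths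
    shape  : map length depths ≡ t
    deeper : totalDepth depths ≡ totalDepth Ds + c
    within : WithinCapacity 0 depths

InsStep-deepening : ∀ {s t c} → InsStep s t c →
                    ∀ Ds → map length Ds ≡ s → WithinCapacity 0 Ds → Deepening Ds t c
InsStep-deepening (fill pre post _ refl) Ds shape within with map-++⁻ length Ds {pre} shape
... | _   , []          , _    , _    , ()
... | _   , (_ ∷ _) ∷ _ , _    , _    , ()
... | Ds₁ , [] ∷ Es     , refl , refl , refl = record
  { depths = Ds₁ ++ [ 1 ] ∷ Es
  ; shape  = map-++ length Ds₁ ([ 1 ] ∷ Es)
  ; deeper = totalDepth-mergeBlock 0 Ds₁ [ [] ] Es refl
  ; within = mergeBlock-within Ds₁ [ [] ] Es 0 refl (λ w → ≤-refl) within }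
InsStep-deepening (merge pre a post _ refl) Ds shape within
  with map-++⁻ length Ds {pre ∷ʳ a} (trans shape (sym (++-assoc pre [ a ] post)))
... | Blk , Es , refl , Blk-shape , refl = record
  { depths = replicate (length pre) [] ++ (1 ∷ deepen Blk) ∷ Es
  ; shape  = trans (shape-mergeBlock (length pre) [] (1 ∷ deepen Blk) Es)
                   (cong (λ x → replicate (length pre) 0 ++ suc x ∷ map length Es) |deepen-Blk|)
  ; deeper = totalDepth-mergeBlock (length pre) [] Blk Es
               (cong suc (trans (sum-deepen Blk) (cong (_+ totalDepth Blk) sum-Blk)))
  ; within = mergeBlock-within [] Blk Es (length pre)
               (sym (trans (sym (length-map length Blk)) (trans (cong length Blk-shape) (length-∷ʳ pre a))))
               (λ w → ≤-refl) within }
  where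
    sum-Blk : sum (map length Blk) ≡ sum pre + a
    sum-Blk = trans (cong sum Blk-shape) (sum-∷ʳ pre a)
    |deepen-Blk| : length (deepen Blk) ≡ sum pre + a
    |deepen-Blk| = trans (length-deepen Blk) sum-Blk

MergeStep-deepening : ∀ {s t c} → MergeStep s t c →
                      ∀ Ds → map length Ds ≡ s → WithinCapacity 0 Ds → Deepening Ds t c
MergeStep-deepening (mergeRange pre mid post 2≤|mid| refl) Ds shape within
  with map-++⁻ length Ds {pre} shape
... | Ds₁ , Ds₂ , refl , refl , Ds₂-shape with map-++⁻ length Ds₂ {mid} Ds₂-shape
... | Blk , Es , refl , refl , refl = record
  { depths = replicate d [] ++ Ds₁ ++ deepen Blk ∷ Es
  ; shape  = trans (shape-mergeBlock d Ds₁ (deepen Blk) Es)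
                   (cong (λ x → replicate d 0 ++ map length Ds₁ ++ x ∷ map length Es) (length-deepen Blk))
  ; deeper = totalDepth-mergeBlock d Ds₁ Blk Es (sum-deepen Blk)
  ; within = mergeBlock-within Ds₁ Blk Es d
               (trans (m+[n∸m]≡n {1} (≤-trans (s≤s z≤n) 2≤|mid|)) (length-map length Blk))
               (λ w → m≤n+m _ _) within }
  where
    d = length (map length Blk) ∸ 1

record Outcome (Ds : Depths) (s : State) (n c : ℕ) : Set where
  field
    depths : Depths
    within : WithinCapacity 0 depths
    deeper : totalDepth depths ≡ totalDepth Ds + c
    items  : length (concat depths) ≡ sum s + n
    slots  : length depths ≡ length s

Ext-outcome : ∀ {s n c} → Ext s n c → ∀ Ds → map length Ds ≡ s → WithinCapacity 0 Ds → Outcome Ds s n c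
Ext-outcome done Ds shape within = record
  { depths = Ds ; within = within
  ; deeper = sym (+-identityʳ _)
  ; items  = trans (length-concat Ds) (trans (cong sum shape) (sym (+-identityʳ _)))
  ; slots  = trans (sym (length-map length Ds)) (cong length shape) }
Ext-outcome (ins {s} {n = n} {c} {d} move ext) Ds shape within = record
  { depths = O.depths ; within = O.within
  ; deeper = trans O.deeper (trans (cong (_+ d) D.deeper) (+-assoc (totalDepth Ds) c d))
  ; items  = trans O.items (trans (cong (_+ n) (InsStep-sum move)) (sym (+-suc (sum s) n)))
  ; slots  = trans O.slots (InsStep-length move) }
  where
    module D = Deepening (InsStep-deepening move Ds shape within)
    module O = Outcome (Ext-outcome ext D.depths D.shape D.within)
Ext-outcome (mrg {n = n} {c} {d} move ext) Ds shape within = record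
  { depths = O.depths ; within = O.within
  ; deeper = trans O.deeper (trans (cong (_+ d) D.deeper) (+-assoc (totalDepth Ds) c d))
  ; items  = trans O.items (cong (_+ n) (MergeStep-sum move))
  ; slots  = trans O.slots (MergeStep-length move) }
  where
    module D = Deepening (MergeStep-deepening move Ds shape within)
    module O = Outcome (Ext-outcome ext D.depths D.shape D.within)

optimalCost-≤-Ext : ∀ k {N c} → Ext (initial k) N c → optimalCost k N ≤ c
optimalCost-≤-Ext k {N} {c} ext = begin
  sumBelow N (λ w → N ∸ capacityUpTo k w)
    ≤⟨ sumBelow-mono-≤ N (λ w → ∸-mono (≤-reflexive (sym items≡N)) (shallow-items w)) ⟩
  sumBelow N (λ w → length (concat depths) ∸ count≤ w (concat depths))
    ≤⟨ sumBelow-count>-≤-sum N (concat depths) ⟩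
  totalDepth depths
    ≡⟨ trans deeper (cong (_+ c) (cong sum (concat-empties k))) ⟩
  c ∎
  where
    open ≤-Reasoning
    open Outcome (Ext-outcome ext (replicate k []) (map-replicate length k []) (within-empties 0 k))
    items≡N : length (concat depths) ≡ N
    items≡N = trans items (cong (_+ N) (sum-zeros k))
    shallow-items : ∀ w → count≤ w (concat depths) ≤ capacityUpTo k w
    shallow-items w = ≤-trans (m≤m+n _ 0)
      (≤-trans (count≤-concat 0 depths within w)
               (≤-reflexive (cong (λ i → capacityUpTo i w) (trans slots (length-replicate k)))))

lemma8p12 : (k : ℕ) → 1 ≤ k → (N : ℕ) →
    Σ ℕ (λ C → IsMin (Orig (initial k) N) C × IsMin (Ext (initial k) N) C)
lemma8p12 zero     () N
lemma8p12 (suc k′) _  N =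
  cost , (Run⇒Orig run , λ c o → ≤-trans cost≤ (optimalCost-≤-Ext (suc k′) (Orig⇒Ext o)))
       , (Orig⇒Ext (Run⇒Orig run) , λ c e → ≤-trans cost≤ (optimalCost-≤-Ext (suc k′) e))
  where open CheapRun (cheapRun k′ N)
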